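{- The $\lambda^{\Box\rightarrow\wedge\vee}$-calculus (on untyped terms) is strongly normalizing with respect to the permutation conversions $>_P$: there is no infinite sequence $t_0>_P t_1>_P\cdots$.
   Context: Terms of $\lambda^{\Box\rightarrow\wedge\vee}$: $x\mid \lambda x.t\mid ts\mid \langle t,s\rangle\mid \pi_1 t\mid \pi_2 t\mid \mathsf{in}_1 t\mid \mathsf{in}_2 t\mid \mathsf{C}_{x,y}(t,t_1,t_2)\mid \mathsf{B}_{x_1,\dots,x_n}(t_1,\dots,t_n)\,\mathsf{in}\,s$ ($\mathsf{C}$ binds $x$ in $t_1$, $y$ in $t_2$; $\mathsf{B}$ binds $x_1,\dots,x_n$ in $s$). Permutations $>_P$ (closed under term contexts): $\mathsf{C}_{x,y}(t,t_1,t_2)s>\mathsf{C}_{x,y}(t,t_1s,t_2s)$; $\pi_i\mathsf{C}_{x,y}(t,t_1,t_2)>\mathsf{C}_{x,y}(t,\pi_it_1,\pi_it_2)$; $\mathsf{C}_{u,v}(\mathsf{C}_{x,y}(t,t_1,t_2),s_1,s_2)>\mathsf{C}_{x,y}(t,\mathsf{C}_{u,v}(t_1,s_1,s_2),\mathsf{C}_{u,v}(t_2,s_1,s_2))$; $\mathsf{B}_{\vec x}(t_1,\dots,t_{i-1},\mathsf{C}_{x,y}(t,s_1,s_2),t_{i+1},\dots,t_n)\,\mathsf{in}\,s>\mathsf{C}_{x,y}(t,\mathsf{B}_{\vec x}(t_1,\dots,t_{i-1},s_1,t_{i+1},\dots,t_n)\,\mathsf{in}\,s,\ \mathsf{B}_{\vec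 x}(t_1,\dots,t_{i-1},s_2,t_{i+1},\dots,t_n)\,\mathsf{in}\,s)$. -}

module Defs where

open import Data.Nat using (ℕ; zero; suc; _+_)
open import Data.List using (List; []; _∷_; _++_; length; map)

-- Untyped raw terms of λ^{□→∧∨} in de Bruijn notation (index 0 = innermost binder).
--   C t t₁ t₂      : C_{x,y}(t,t₁,t₂); t₁ and t₂ each bind one variable (index 0)
--   B ts s         : B_{x₁..xₙ}(t₁..tₙ) in s; s binds n = length ts variables
data Tm : Set where
  var  : ℕ → Tm
  lam  : Tm → Tm
  app  : Tm → Tm → Tm
  pair : Tm → Tm → Tm
  π₁   : Tm → Tm
  π₂   : Tm → Tm
  in₁  : Tm → Tm
  in₂  : Tm → Tm
  C    : Tm → Tm → Tm → Tm
  B    : List Tm → Tm → Tm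

lift : (ℕ → ℕ) → ℕ → ℕ
lift ρ zero    = zero
lift ρ (suc i) = suc (ρ i)

liftN : ℕ → (ℕ → ℕ) → ℕ → ℕ
liftN zero    ρ = ρ
liftN (suc n) ρ = lift (liftN n ρ)

mutual
  rename : (ℕ → ℕ) → Tm → Tm
  rename ρ (var i)     = var (ρ i)
  rename ρ (lam t)     = lam (rename (lift ρ) t)
  rename ρ (app t s)   = app (rename ρ t) (rename ρ s)
  rename ρ (pair t s)  = pair (rename ρ t) (rename ρ s)
  rename ρ (π₁ t)      = π₁ (rename ρ t)
  rename ρ (π₂ t)      = π₂ (rename ρ t)
  rename ρ (in₁ t)     = in₁ (rename ρ t)
  rename ρ (in₂ t)     = in₂ (rename ρ t)
  rename ρ (C t t₁ t₂) = C (rename ρ t) (rename (lift ρ) t₁) (rename (lift ρ) t₂)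
  rename ρ (B ts s)    = B (renameList ρ ts) (rename (liftN (length ts) ρ) s)

  renameList : (ℕ → ℕ) → List Tm → List Tm
  renameList ρ []       = []
  renameList ρ (t ∷ ts) = rename ρ t ∷ renameList ρ ts

wk : Tm → Tm
wk = rename suc

-- Permutation conversions >_P, closed under all term contexts.
-- (Side conditions of the named presentation — bound variables not free in
--  the moved terms — are realised by the weakenings.)
infix 4 _>P_
data _>P_ : Tm → Tm → Set where
  p-app : ∀ {t t₁ t₂ s} →
    app (C t t₁ t₂) s >P C t (app t₁ (wk s)) (app t₂ (wk s))
  p-π₁ : ∀ {t t₁ t₂} → π₁ (C t t₁ t₂) >P C t (π₁ t₁) (π₁ t₂)
  p-π₂ : ∀ {t t₁ t₂} → π₂ (C t t₁ t₂) >P C t (π₂ t₁) (π₂ t₂)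
  p-C  : ∀ {t t₁ t₂ s₁ s₂} →
    C (C t t₁ t₂) s₁ s₂ >P
      C t (C t₁ (rename (lift suc) s₁) (rename (lift suc) s₂))
          (C t₂ (rename (lift suc) s₁) (rename (lift suc) s₂))
  p-B  : ∀ {ts us t s₁ s₂ s} →
    B (ts ++ C t s₁ s₂ ∷ us) s >P
      C t (B (map wk ts ++ s₁ ∷ map wk us) (rename (liftN (suc (length ts + length us)) suc) s))
          (B (map wk ts ++ s₂ ∷ map wk us) (rename (liftN (suc (length ts + length us)) suc) s))
  c-lam  : ∀ {t t'} → t >P t' → lam t >P lam t'
  c-appˡ : ∀ {t t' s} → t >P t' → app t s >P app t' s
  c-appʳ : ∀ {t s s'} → s >P s' → app t s >P app t s'
  c-pairˡ : ∀ {t t' s} → t >P t' → pair t s >P pair t' s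
  c-pairʳ : ∀ {t s s'} → s >P s' → pair t s >P pair t s'
  c-π₁ : ∀ {t t'} → t >P t' → π₁ t >P π₁ t'
  c-π₂ : ∀ {t t'} → t >P t' → π₂ t >P π₂ t'
  c-in₁ : ∀ {t t'} → t >P t' → in₁ t >P in₁ t'
  c-in₂ : ∀ {t t'} → t >P t' → in₂ t >P in₂ t'
  c-C₀ : ∀ {t t' t₁ t₂} → t >P t' → C t t₁ t₂ >P C t' t₁ t₂
  c-C₁ : ∀ {t t₁ t₁' t₂} → t₁ >P t₁' → C t t₁ t₂ >P C t t₁' t₂
  c-C₂ : ∀ {t t₁ t₂ t₂'} → t₂ >P t₂' → C t t₁ t₂ >P C t t₁ t₂'
  c-Bᵢ : ∀ {ts us t t' s} → t >P t' → B (ts ++ t ∷ us) s >P B (ts ++ t' ∷ us) s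
  c-Bₛ : ∀ {ts s s'} → s >P s' → B ts s >P B ts s'

{-# OPTIONS --safe #-}
module Submission where

-- Weigh terms in ℕ so that every constructor is strictly monotone in its arguments, variables weigh
-- 2, and a case C t t₁ t₂ weighs weight t · (1 + weight t₁ + weight t₂). A permutation moves a
-- context of weight k ≥ 2 (an argument, a projection, an outer case, or the other arguments and
-- body of a B) from around a case into both of its branches; this turns m · (1 + x + y) · k into
-- m · (1 + x · k + y · k), which is smaller because the 1 is no longer multiplied by k. Hence >P
-- decreases the weight and so admits no infinite chain.

open import Defs
open import Data.Empty using (⊥)
open import Data.List using (List; []; _∷_; _++_; length; map)
open import Data.Nat using (ℕ; suc; _+_; _*_; _<_; z<s; s<s; NonZero; >-nonZero)
open import Data.Nat.Induction using (<-wellFounded)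
open import Data.Nat.Properties
open import Data.Nat.Tactic.RingSolver using (solve-∀)
open import Induction.InfiniteDescent using (InfiniteDescendingSequence)
open import Induction.WellFounded using (WellFounded; Acc; acc; module Subrelation)
open import Relation.Binary.Construct.On as On using ()
open import Relation.Binary.PropositionalEquality using (_≡_; refl; sym; trans; cong; cong₂)
open import Relation.Nullary using (¬_)

mutual
  weight : Tm → ℕ
  weight (var _)     = 2
  weight (lam t)     = suc (weight t)
  weight (app t s)   = weight t * weight s
  weight (pair t s)  = weight t + weight s
  weight (π₁ t)      = 2 * weight t
  weight (π₂ t)      = 2 * weight t
  weight (in₁ t)     = suc (weight t)
  weight (in₂ t)     = suc (weight t)
  weight (C t t₁ t₂) = weight t * suc (weight t₁ + weight t₂)
  weight (B ts s)    = weights ts * weight s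

  weights : List Tm → ℕ
  weights []       = 1
  weights (t ∷ ts) = weight t * weights ts

mutual
  1<weight : ∀ t → 1 < weight t
  1<weight (var _)     = s<s z<s
  1<weight (lam t)     = m<n⇒m<1+n (1<weight t)
  1<weight (app t s)   = *-mono-≤ (1<weight t) (m<n⇒0<n (1<weight s))
  1<weight (pair t s)  = <-≤-trans (1<weight t) (m≤m+n (weight t) (weight s))
  1<weight (π₁ t)      = m<n⇒m<o*n 2 (1<weight t)
  1<weight (π₂ t)      = m<n⇒m<o*n 2 (1<weight t)
  1<weight (in₁ t)     = m<n⇒m<1+n (1<weight t)
  1<weight (in₂ t)     = m<n⇒m<1+n (1<weight t)
  1<weight (C t t₁ t₂) = m<n⇒m<n*o (suc (weight t₁ + weight t₂)) (1<weight t)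
  1<weight (B ts s)    = *-mono-≤ (0<weights ts) (1<weight s)

  0<weights : ∀ ts → 0 < weights ts
  0<weights []       = z<s
  0<weights (t ∷ ts) = *-mono-≤ (m<n⇒0<n (1<weight t)) (0<weights ts)

weight-nonZero : ∀ t → NonZero (weight t)
weight-nonZero t = >-nonZero (m<n⇒0<n (1<weight t))

weights-nonZero : ∀ ts → NonZero (weights ts)
weights-nonZero ts = >-nonZero (0<weights ts)

mutual
  weight-rename : ∀ ρ t → weight (rename ρ t) ≡ weight t
  weight-rename ρ (var _)     = refl
  weight-rename ρ (lam t)     = cong suc (weight-rename (lift ρ) t)
  weight-rename ρ (app t s)   = cong₂ _*_ (weight-rename ρ t) (weight-rename ρ s)
  weight-rename ρ (pair t s)  = cong₂ _+_ (weight-rename ρ t) (weight-rename ρ s)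
  weight-rename ρ (π₁ t)      = cong (2 *_) (weight-rename ρ t)
  weight-rename ρ (π₂ t)      = cong (2 *_) (weight-rename ρ t)
  weight-rename ρ (in₁ t)     = cong suc (weight-rename ρ t)
  weight-rename ρ (in₂ t)     = cong suc (weight-rename ρ t)
  weight-rename ρ (C t t₁ t₂) = cong₂ _*_ (weight-rename ρ t)
    (cong suc (cong₂ _+_ (weight-rename (lift ρ) t₁) (weight-rename (lift ρ) t₂)))
  weight-rename ρ (B ts s)    =
    cong₂ _*_ (weights-renameList ρ ts) (weight-rename (liftN (length ts) ρ) s)

  weights-renameList : ∀ ρ ts → weights (renameList ρ ts) ≡ weights ts
  weights-renameList ρ []       = refl
  weights-renameList ρ (t ∷ ts) = cong₂ _*_ (weight-rename ρ t) (weights-renameList ρ ts)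

weights-map-rename : ∀ ρ ts → weights (map (rename ρ) ts) ≡ weights ts
weights-map-rename ρ []       = refl
weights-map-rename ρ (t ∷ ts) = cong₂ _*_ (weight-rename ρ t) (weights-map-rename ρ ts)

weights-++ : ∀ ts us → weights (ts ++ us) ≡ weights ts * weights us
weights-++ []       us = sym (+-identityʳ (weights us))
weights-++ (t ∷ ts) us =
  trans (cong (weight t *_) (weights-++ ts us)) (sym (*-assoc (weight t) (weights ts) (weights us)))

weights-wk-++ : ∀ ts r us →
  weights (map wk ts ++ r ∷ map wk us) ≡ weights ts * (weight r * weights us)
weights-wk-++ ts r us = trans (weights-++ (map wk ts) (r ∷ map wk us))
  (cong₂ (λ p q → p * (weight r * q)) (weights-map-rename suc ts) (weights-map-rename suc us))

weights-monoᵢ-< : ∀ ts {t t'} us →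
  weight t' < weight t → weights (ts ++ t' ∷ us) < weights (ts ++ t ∷ us)
weights-monoᵢ-< []        us t'<t = *-monoˡ-< (weights us) {{weights-nonZero us}} t'<t
weights-monoᵢ-< (t₀ ∷ ts) us t'<t =
  *-monoʳ-< (weight t₀) {{weight-nonZero t₀}} (weights-monoᵢ-< ts us t'<t)

m*[1+x*k+y*k]<m*[1+x+y]*k : ∀ m x y k .{{_ : NonZero m}} → 1 < k →
                             m * suc (x * k + y * k) < m * suc (x + y) * k
m*[1+x*k+y*k]<m*[1+x+y]*k m x y k 1<k = begin-strict
  m * suc (x * k + y * k)  ≡⟨ cong (λ n → m * suc n) (*-distribʳ-+ k x y) ⟨
  m * suc ((x + y) * k)    <⟨ *-monoʳ-< m (+-monoˡ-< ((x + y) * k) 1<k) ⟩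
  m * (suc (x + y) * k)    ≡⟨ *-assoc m (suc (x + y)) k ⟨
  m * suc (x + y) * k      ∎
  where open ≤-Reasoning

permute-app-< : ∀ t t₁ t₂ s →
  weight (C t (app t₁ (wk s)) (app t₂ (wk s))) < weight (app (C t t₁ t₂) s)
permute-app-< t t₁ t₂ s rewrite weight-rename suc s =
  m*[1+x*k+y*k]<m*[1+x+y]*k (weight t) (weight t₁) (weight t₂) (weight s) {{weight-nonZero t}}
    (1<weight s)

permute-π-< : ∀ t t₁ t₂ → weight (C t (π₁ t₁) (π₁ t₂)) < weight (π₁ (C t t₁ t₂))
permute-π-< t t₁ t₂ = begin-strict
  T * suc (2 * x + 2 * y)  ≡⟨ cong (λ n → T * suc n) (cong₂ _+_ (*-comm 2 x) (*-comm 2 y)) ⟩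
  T * suc (x * 2 + y * 2)  <⟨ m*[1+x*k+y*k]<m*[1+x+y]*k T x y 2 {{weight-nonZero t}} (s<s z<s) ⟩
  T * suc (x + y) * 2      ≡⟨ *-comm (T * suc (x + y)) 2 ⟩
  2 * (T * suc (x + y))    ∎
  where
  open ≤-Reasoning
  T = weight t; x = weight t₁; y = weight t₂

permute-C-< : ∀ t t₁ t₂ s₁ s₂ →
  let s₁' = rename (lift suc) s₁; s₂' = rename (lift suc) s₂ in
  weight (C t (C t₁ s₁' s₂') (C t₂ s₁' s₂')) < weight (C (C t t₁ t₂) s₁ s₂)
permute-C-< t t₁ t₂ s₁ s₂ rewrite weight-rename (lift suc) s₁ | weight-rename (lift suc) s₂ =
  m*[1+x*k+y*k]<m*[1+x+y]*k (weight t) (weight t₁) (weight t₂) (suc (weight s₁ + weight s₂))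
    {{weight-nonZero t}} (s<s (<-≤-trans (m<n⇒0<n (1<weight s₁)) (m≤m+n (weight s₁) (weight s₂))))

permute-B-< : ∀ ts us t s₁ s₂ s →
  let s' = rename (liftN (suc (length ts + length us)) suc) s in
  weight (C t (B (map wk ts ++ s₁ ∷ map wk us) s') (B (map wk ts ++ s₂ ∷ map wk us) s'))
    < weight (B (ts ++ C t s₁ s₂ ∷ us) s)
permute-B-< ts us t s₁ s₂ s
  rewrite weights-wk-++ ts s₁ us | weights-wk-++ ts s₂ us
        | weight-rename (liftN (suc (length ts + length us)) suc) s
        | weights-++ ts (C t s₁ s₂ ∷ us) = begin-strict
  T * suc (P * (x * Q) * S + P * (y * Q) * S)  ≡⟨ cong (λ n → T * suc n) (distribute P Q S x y) ⟩
  T * suc (x * K + y * K)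
    <⟨ m*[1+x*k+y*k]<m*[1+x+y]*k T x y K {{weight-nonZero t}} 1<K ⟩
  T * suc (x + y) * K                          ≡⟨ reassociate P Q S T (suc (x + y)) ⟩
  P * (T * suc (x + y) * Q) * S                ∎
  where
  open ≤-Reasoning
  T = weight t; x = weight s₁; y = weight s₂; S = weight s; P = weights ts; Q = weights us
  K = P * Q * S

  1<K : 1 < K
  1<K = *-mono-≤ (*-mono-≤ (0<weights ts) (0<weights us)) (1<weight s)

  distribute : ∀ P Q S x y →
    P * (x * Q) * S + P * (y * Q) * S ≡ x * (P * Q * S) + y * (P * Q * S)
  distribute = solve-∀

  reassociate : ∀ P Q S T c → T * c * (P * Q * S) ≡ P * (T * c * Q) * S
  reassociate = solve-∀

weight-decreasing : ∀ {t t'} → t >P t' → weight t' < weight t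
weight-decreasing (p-app {t} {t₁} {t₂} {s})         = permute-app-< t t₁ t₂ s
weight-decreasing (p-π₁ {t} {t₁} {t₂})              = permute-π-< t t₁ t₂
weight-decreasing (p-π₂ {t} {t₁} {t₂})              = permute-π-< t t₁ t₂
weight-decreasing (p-C {t} {t₁} {t₂} {s₁} {s₂})     = permute-C-< t t₁ t₂ s₁ s₂
weight-decreasing (p-B {ts} {us} {t} {s₁} {s₂} {s}) = permute-B-< ts us t s₁ s₂ s
weight-decreasing (c-lam p)                         = s<s (weight-decreasing p)
weight-decreasing (c-appˡ {s = s} p)                =
  *-monoˡ-< (weight s) {{weight-nonZero s}} (weight-decreasing p)
weight-decreasing (c-appʳ {t} p)                    =
  *-monoʳ-< (weight t) {{weight-nonZero t}} (weight-decreasing p)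
weight-decreasing (c-pairˡ {s = s} p)               = +-monoˡ-< (weight s) (weight-decreasing p)
weight-decreasing (c-pairʳ {t} p)                   = +-monoʳ-< (weight t) (weight-decreasing p)
weight-decreasing (c-π₁ p)                          = *-monoʳ-< 2 (weight-decreasing p)
weight-decreasing (c-π₂ p)                          = *-monoʳ-< 2 (weight-decreasing p)
weight-decreasing (c-in₁ p)                         = s<s (weight-decreasing p)
weight-decreasing (c-in₂ p)                         = s<s (weight-decreasing p)
weight-decreasing (c-C₀ {t₁ = t₁} {t₂} p)           =
  *-monoˡ-< (suc (weight t₁ + weight t₂)) (weight-decreasing p)
weight-decreasing (c-C₁ {t} {t₂ = t₂} p)            =
  *-monoʳ-< (weight t) {{weight-nonZero t}} (s<s (+-monoˡ-< (weight t₂) (weight-decreasing p)))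
weight-decreasing (c-C₂ {t} {t₁} p)                 =
  *-monoʳ-< (weight t) {{weight-nonZero t}} (s<s (+-monoʳ-< (weight t₁) (weight-decreasing p)))
weight-decreasing (c-Bᵢ {ts} {us} {s = s} p)        =
  *-monoˡ-< (weight s) {{weight-nonZero s}} (weights-monoᵢ-< ts us (weight-decreasing p))
weight-decreasing (c-Bₛ {ts} p)                     =
  *-monoʳ-< (weights ts) {{weights-nonZero ts}} (weight-decreasing p)

wf⇒¬InfiniteDescendingSequence : ∀ {a r} {A : Set a} {_<_ : A → A → Set r} →
  WellFounded _<_ → (f : ℕ → A) → ¬ InfiniteDescendingSequence _<_ f
wf⇒¬InfiniteDescendingSequence {_<_ = _<_} wf f descends = unreachable 0 (wf (f 0))
  where
  unreachable : ∀ n → Acc _<_ (f n) → ⊥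
  unreachable n (acc rs) = unreachable (suc n) (rs (descends n))

_<P_ : Tm → Tm → Set
t' <P t = t >P t'

<P-wellFounded : WellFounded _<P_
<P-wellFounded = Subrelation.wellFounded weight-decreasing (On.wellFounded weight <-wellFounded)

lemma8 : (f : ℕ → Tm) → ¬ ((n : ℕ) → f n >P f (suc n))
lemma8 = wf⇒¬InfiniteDescendingSequence <P-wellFounded
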